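{- Let $G$ be a graph on $n\ge 5$ vertices and $m$ edges. If $\chi_s(G)=n-1$, then $m>\frac{n^2-n-n\sqrt{n}}{2}$.
   Context: Standing assumption of the paper: all graphs are finite, undirected, simple and connected. A star coloring of $G$ is a proper vertex-coloring such that no path on four vertices (as a subgraph) is colored with only two colors; $\chi_s(G)$ is the minimum number of colors in a star coloring of $G$. -}

module Defs where

open import Data.Nat using (ℕ; zero; suc; _+_; _<_; _<?_)
open import Data.Fin using (Fin; toℕ)
open import Data.List using (List; map; allFin)
open import Data.Nat.ListAction using (sum)
open import Data.Product using (_×_; ∃; ∃-syntax; _,_)
open import Data.Sum using (_⊎_)
open import Relation.Nullary using (¬_; Dec; yes; no)
open import Relation.Binary.PropositionalEquality using (_≡_; _≢_)

record Graph (n : ℕ) : Set₁ where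
  field
    Adj     : Fin n → Fin n → Set
    adj?    : ∀ u v → Dec (Adj u v)
    irrefl  : ∀ u → ¬ Adj u u
    sym     : ∀ {u v} → Adj u v → Adj v u
open Graph public

data Reach {n : ℕ} (G : Graph n) : Fin n → Fin n → Set where
  here : ∀ {u} → Reach G u u
  step : ∀ {u v w} → Adj G u v → Reach G v w → Reach G u w

Connected : ∀ {n} → Graph n → Set
Connected G = ∀ u v → Reach G u v

countAdj : ∀ {n} (G : Graph n) → Fin n → Fin n → ℕ
countAdj G i j with adj? G i j | toℕ i <? toℕ j
... | yes _ | yes _ = 1
... | _ | _ = 0

numEdges : ∀ {n} → Graph n → ℕ
numEdges {n} G = sum (map (λ i → sum (map (λ j → countAdj G i j) (allFin n))) (allFin n))

Coloring : ℕ → ℕ → Set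
Coloring n k = Fin n → Fin k

Proper : ∀ {n k} → Graph n → Coloring n k → Set
Proper G c = ∀ u v → Adj G u v → c u ≢ c v

IsP4 : ∀ {n} → Graph n → Fin n → Fin n → Fin n → Fin n → Set
IsP4 G a b c d =
  (a ≢ b × a ≢ c × a ≢ d × b ≢ c × b ≢ d × c ≢ d) ×
  (Adj G a b × Adj G b c × Adj G c d)

UsesAtMostTwoColors : ∀ {n k} → Coloring n k → Fin n → Fin n → Fin n → Fin n → Set
UsesAtMostTwoColors {n} {k} col a b c d =
  ∃[ x ] ∃[ y ] (In x y (col a) × In x y (col b) × In x y (col c) × In x y (col d))
  where
  In : Fin k → Fin k → Fin k → Set
  In x y z = z ≡ x ⊎ z ≡ y

StarColoring : ∀ {n k} → Graph n → Coloring n k → Set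
StarColoring G col =
  Proper G col ×
  (∀ a b c d → IsP4 G a b c d → ¬ UsesAtMostTwoColors col a b c d)

StarColorable : ∀ {n} → Graph n → ℕ → Set
StarColorable {n} G k = ∃[ col ] StarColoring {n} {k} G col

StarChromaticNumber : ∀ {n} → Graph n → ℕ → Set
StarChromaticNumber G k = StarColorable G k × (∀ j → j < k → ¬ StarColorable G j)

-- If χₛ(G) = n − 1, the complement Ḡ contains neither a triangle nor a 4-cycle: colour each
-- vertex by itself and give b and c the colour of a, for a triangle a b c of Ḡ, or b the colour
-- of a and d that of c, for a 4-cycle a b c d of Ḡ; the result is a star colouring using only
-- n − 2 colours.  In a graph of girth at least 5, two vertices v ≠ w have at most one common
-- neighbour and none when adjacent, so Σ_{u ∼ v} d(u) ≤ n − 1; summing over v gives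
-- Σ d(u)² ≤ n(n − 1), and Cauchy–Schwarz bounds (Σ d(u))² by n Σ d(u)² < n³.  For Ḡ,
-- Σ d(u) = n² − n − 2m.

module Submission where

open import Defs
open import Data.Nat
  using (ℕ; zero; suc; _+_; _*_; _∸_; _^_; _≤_; _<_; z≤n; s≤s; _<?_; NonZero; >-nonZero⁻¹)
open import Data.Nat.Properties hiding (_≟_)
open import Data.Nat.Tactic.RingSolver using (solve-∀)
import Data.Nat.ListAction as List using (sum)
open import Data.Bool using (if_then_else_)
open import Data.Fin using (Fin; zero; suc; toℕ; punchOut)
open import Data.Fin.Properties using (_≟_; toℕ-injective; punchOut-injective)
import Data.Fin.Properties as Fin using (suc-injective)
import Data.List as List using (tabulate; map; allFin)
open import Data.List.Properties using (map-tabulate)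
open import Data.Product using (_×_; _,_; proj₁; proj₂)
open import Data.Sum using (_⊎_; inj₁; inj₂)
open import Data.Empty using (⊥; ⊥-elim)
open import Function using (_∘_; id)
open import Relation.Nullary using (¬_; Dec; does; yes; no; ¬?)
open import Relation.Nullary.Decidable using (_×-dec_)
open import Relation.Binary.PropositionalEquality as ≡
  using (_≡_; _≢_; refl; cong; cong₂; trans; subst₂)
open import Algebra.Properties.Semiring.Sum +-*-semiring

sum-mono-≤ : ∀ {n} {f g : Fin n → ℕ} → (∀ i → f i ≤ g i) → sum f ≤ sum g
sum-mono-≤ {zero}  _   = z≤n
sum-mono-≤ {suc n} f≤g = +-mono-≤ (f≤g zero) (sum-mono-≤ (f≤g ∘ suc))

sum-const : ∀ n c → ∑[ i < n ] c ≡ n * c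
sum-const zero    c = refl
sum-const (suc n) c = cong (c +_) (sum-const n c)

2mn≤m²+n²-ordered : ∀ {m n} → m ≤ n → 2 * (m * n) ≤ m * m + n * n
2mn≤m²+n²-ordered {m} m≤n with o , refl ← m≤n⇒∃[o]m+o≡n m≤n = begin
  2 * (m * (m + o))         ≤⟨ m≤m+n _ (o * o) ⟩
  2 * (m * (m + o)) + o * o ≡⟨ expand m o ⟩
  m * m + (m + o) * (m + o) ∎
  where
  open ≤-Reasoning
  expand : ∀ m o → 2 * (m * (m + o)) + o * o ≡ m * m + (m + o) * (m + o)
  expand = solve-∀

2mn≤m²+n² : ∀ m n → 2 * (m * n) ≤ m * m + n * n
2mn≤m²+n² m n with ≤-total m n
... | inj₁ m≤n = 2mn≤m²+n²-ordered m≤n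
... | inj₂ n≤m = subst₂ _≤_ (cong (2 *_) (*-comm n m)) (+-comm (n * n) (m * m))
                        (2mn≤m²+n²-ordered n≤m)

cauchy-schwarz : ∀ {n} (f : Fin n → ℕ) → sum f * sum f ≤ n * ∑[ i < n ] (f i * f i)
cauchy-schwarz {zero}  f = z≤n
cauchy-schwarz {suc n} f = begin
  (a + s) * (a + s)
    ≡⟨ square-+ a s ⟩
  a * a + 2 * (a * s) + s * s
    ≤⟨ +-mono-≤ (+-monoʳ-≤ (a * a) cross-term) (cauchy-schwarz (f ∘ suc)) ⟩
  a * a + (n * (a * a) + q) + n * q
    ≡⟨ regroup a n q ⟩
  suc n * (a * a + q) ∎
  where
  open ≤-Reasoning
  a = f zero
  s = sum (f ∘ suc)
  q = ∑[ i < n ] (f (suc i) * f (suc i))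
  square-+ : ∀ a s → (a + s) * (a + s) ≡ a * a + 2 * (a * s) + s * s
  square-+ = solve-∀
  regroup : ∀ a n q → a * a + (n * (a * a) + q) + n * q ≡ suc n * (a * a + q)
  regroup = solve-∀
  cross-term : 2 * (a * s) ≤ n * (a * a) + q
  cross-term = begin
    2 * (a * s)
      ≡⟨ cong (2 *_) (*-distribˡ-sum a (f ∘ suc)) ⟩
    2 * ∑[ i < n ] (a * f (suc i))
      ≡⟨ *-distribˡ-sum {n} 2 (λ i → a * f (suc i)) ⟩
    ∑[ i < n ] (2 * (a * f (suc i)))
      ≤⟨ sum-mono-≤ (λ i → 2mn≤m²+n² a (f (suc i))) ⟩
    ∑[ i < n ] (a * a + f (suc i) * f (suc i))
      ≡⟨ ∑-distrib-+ {n} (λ _ → a * a) (λ i → f (suc i) * f (suc i)) ⟩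
    ∑[ i < n ] (a * a) + q
      ≡⟨ cong (_+ q) (sum-const n (a * a)) ⟩
    n * (a * a) + q ∎

sum-≤-1 : ∀ {n} (f : Fin n → ℕ) → (∀ i → f i ≤ 1) →
          (∀ i j → 0 < f i → 0 < f j → i ≡ j) → sum f ≤ 1
sum-≤-1 {zero}  f _   _      = z≤n
sum-≤-1 {suc n} f f≤1 unique with 0 <? f zero
... | no f₀≯0 = begin
  f zero + sum (f ∘ suc) ≡⟨ cong (_+ sum (f ∘ suc)) (n≤0⇒n≡0 (≮⇒≥ f₀≯0)) ⟩
  sum (f ∘ suc)          ≤⟨ sum-≤-1 (f ∘ suc) (f≤1 ∘ suc) unique′ ⟩
  1                      ∎
  where
  open ≤-Reasoning
  unique′ : ∀ i j → 0 < f (suc i) → 0 < f (suc j) → i ≡ j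
  unique′ i j fᵢ>0 fⱼ>0 = Fin.suc-injective (unique (suc i) (suc j) fᵢ>0 fⱼ>0)
... | yes f₀>0 = begin
  f zero + sum (f ∘ suc) ≡⟨ cong (f zero +_) (trans (sum-cong-≗ rest-zero) (sum-replicate-zero n)) ⟩
  f zero + 0             ≡⟨ +-identityʳ (f zero) ⟩
  f zero                 ≤⟨ f≤1 zero ⟩
  1                      ∎
  where
  open ≤-Reasoning
  rest-zero : ∀ i → f (suc i) ≡ 0
  rest-zero i with 0 <? f (suc i)
  ... | no fᵢ≯0 = n≤0⇒n≡0 (≮⇒≥ fᵢ≯0)
  ... | yes fᵢ>0 with () ← unique zero (suc i) f₀>0 fᵢ>0

sum-< : ∀ {n c} (f : Fin n → ℕ) → (∀ i → f i < c) → sum f + n ≤ n * c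
sum-< {zero}  f _     = z≤n
sum-< {suc n} {c} f f<c = begin
  f zero + sum (f ∘ suc) + suc n   ≡⟨ regroup (f zero) (sum (f ∘ suc)) n ⟩
  suc (f zero) + (sum (f ∘ suc) + n) ≤⟨ +-mono-≤ (f<c zero) (sum-< (f ∘ suc) (f<c ∘ suc)) ⟩
  c + n * c                         ∎
  where
  open ≤-Reasoning
  regroup : ∀ a s n → a + s + suc n ≡ suc a + (s + n)
  regroup = solve-∀

sum-tabulate : ∀ {n} (f : Fin n → ℕ) → List.sum (List.tabulate f) ≡ sum f
sum-tabulate {zero}  f = refl
sum-tabulate {suc n} f = cong (f zero +_) (sum-tabulate (f ∘ suc))

sum-allFin : ∀ {n} (f : Fin n → ℕ) → List.sum (List.map f (List.allFin n)) ≡ sum f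
sum-allFin f = trans (cong List.sum (map-tabulate id f)) (sum-tabulate f)

𝟙 : ∀ {p} {P : Set p} → Dec P → ℕ
𝟙 p? = if does p? then 1 else 0

sum-𝟙-≟ : ∀ {n} (v : Fin n) → ∑[ u < n ] 𝟙 (v ≟ u) ≡ 1
sum-𝟙-≟ {suc n} zero    = cong suc (trans (sum-const n 0) (*-zeroʳ n))
sum-𝟙-≟ {suc n} (suc v) = sum-𝟙-≟ v

𝟙-≤-1 : ∀ {p} {P : Set p} (p? : Dec P) → 𝟙 p? ≤ 1
𝟙-≤-1 (yes _) = s≤s z≤n
𝟙-≤-1 (no _)  = z≤n

𝟙-idem : ∀ {p} {P : Set p} (p? : Dec P) → 𝟙 p? * 𝟙 p? ≡ 𝟙 p?
𝟙-idem (yes _) = refl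
𝟙-idem (no _)  = refl

complement : ∀ {n} → Graph n → Graph n
complement G = record
  { Adj    = λ u v → u ≢ v × ¬ Adj G u v
  ; adj?   = λ u v → ¬? (u ≟ v) ×-dec ¬? (adj? G u v)
  ; irrefl = λ u (u≢u , _) → u≢u refl
  ; sym    = λ (u≢v , u≁v) → u≢v ∘ ≡.sym , u≁v ∘ sym G
  }

edge : ∀ {n} → Graph n → Fin n → Fin n → ℕ
edge G u v = 𝟙 (adj? G u v)

degree : ∀ {n} → Graph n → Fin n → ℕ
degree {n} G v = ∑[ u < n ] edge G v u

module _ {n} (G : Graph n) where

  edge-sym : ∀ u v → edge G u v ≡ edge G v u
  edge-sym u v with adj? G u v | adj? G v u
  ... | yes _  | yes _  = refl
  ... | no _   | no _   = refl
  ... | yes uv | no ¬vu = ⊥-elim (¬vu (sym G uv))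
  ... | no ¬uv | yes vu = ⊥-elim (¬uv (sym G vu))

  edge-partition : ∀ v u → edge G v u + edge (complement G) v u + 𝟙 (v ≟ u) ≡ 1
  edge-partition v u with v ≟ u | adj? G v u
  ... | yes refl | yes vv = ⊥-elim (irrefl G v vv)
  ... | yes _    | no _   = refl
  ... | no _     | yes _  = refl
  ... | no _     | no _   = refl

  degree-partition : ∀ v → degree G v + degree (complement G) v + 1 ≡ n
  degree-partition v = begin
    degree G v + degree (complement G) v + 1
      ≡⟨ cong (degree G v + degree (complement G) v +_) (≡.sym (sum-𝟙-≟ v)) ⟩
    degree G v + degree (complement G) v + ∑[ u < n ] 𝟙 (v ≟ u)
      ≡⟨ cong (_+ ∑[ u < n ] 𝟙 (v ≟ u)) (∑-distrib-+ (edge G v) (edge (complement G) v)) ⟨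
    ∑[ u < n ] (edge G v u + edge (complement G) v u) + ∑[ u < n ] 𝟙 (v ≟ u)
      ≡⟨ ∑-distrib-+ (λ u → edge G v u + edge (complement G) v u) (λ u → 𝟙 (v ≟ u)) ⟨
    ∑[ u < n ] (edge G v u + edge (complement G) v u + 𝟙 (v ≟ u))
      ≡⟨ sum-cong-≗ (edge-partition v) ⟩
    ∑[ u < n ] 1
      ≡⟨ sum-const n 1 ⟩
    n * 1
      ≡⟨ *-identityʳ n ⟩
    n ∎
    where open ≡.≡-Reasoning

  edge-countAdj : ∀ v u → edge G v u ≡ countAdj G v u + countAdj G u v
  edge-countAdj v u with adj? G v u | toℕ v <? toℕ u | adj? G u v | toℕ u <? toℕ v
  ... | no _   | _       | no _   | _       = refl
  ... | yes _  | yes _   | yes _  | no _    = refl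
  ... | yes _  | no _    | yes _  | yes _   = refl
  ... | no ¬vu | _       | yes uv | _       = ⊥-elim (¬vu (sym G uv))
  ... | yes vu | _       | no ¬uv | _       = ⊥-elim (¬uv (sym G vu))
  ... | yes _  | yes v<u | yes _  | yes u<v = ⊥-elim (<-asym v<u u<v)
  ... | yes vu | no v≮u  | yes _  | no u≮v  =
    ⊥-elim (irrefl G v (≡.subst (Adj G v) (≡.sym v≡u) vu))
    where
    v≡u : v ≡ u
    v≡u = toℕ-injective (≤-antisym (≮⇒≥ u≮v) (≮⇒≥ v≮u))

  numEdges-∑ : numEdges G ≡ ∑[ v < n ] ∑[ u < n ] countAdj G v u
  numEdges-∑ = trans (sum-allFin (λ v → List.sum (List.map (countAdj G v) (List.allFin n))))
                     (sum-cong-≗ λ v → sum-allFin (countAdj G v))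

  handshake : ∑[ v < n ] degree G v ≡ 2 * numEdges G
  handshake = begin
    ∑[ v < n ] ∑[ u < n ] edge G v u
      ≡⟨ sum-cong-≗ (λ v → trans (sum-cong-≗ (edge-countAdj v))
                                 (∑-distrib-+ (countAdj G v) (λ u → countAdj G u v))) ⟩
    ∑[ v < n ] (∑[ u < n ] countAdj G v u + ∑[ u < n ] countAdj G u v)
      ≡⟨ ∑-distrib-+ (λ v → ∑[ u < n ] countAdj G v u) _ ⟩
    m + ∑[ v < n ] ∑[ u < n ] countAdj G u v
      ≡⟨ cong (m +_) (∑-comm (countAdj G)) ⟨
    m + m
      ≡⟨ cong (λ m → m + m) numEdges-∑ ⟨
    numEdges G + numEdges G
      ≡⟨ cong (numEdges G +_) (+-identityʳ (numEdges G)) ⟨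
    2 * numEdges G ∎
    where
    open ≡.≡-Reasoning
    m = ∑[ v < n ] ∑[ u < n ] countAdj G v u

  handshake-complement : 2 * numEdges G + ∑[ v < n ] degree (complement G) v + n ≡ n * n
  handshake-complement = begin
    2 * numEdges G + ∑[ v < n ] degree (complement G) v + n
      ≡⟨ cong₂ (λ e c → e + ∑[ v < n ] degree (complement G) v + c) handshake
               (trans (sum-const n 1) (*-identityʳ n)) ⟨
    ∑[ v < n ] degree G v + ∑[ v < n ] degree (complement G) v + ∑[ v < n ] 1
      ≡⟨ cong (_+ ∑[ v < n ] 1) (∑-distrib-+ (degree G) (degree (complement G))) ⟨
    ∑[ v < n ] (degree G v + degree (complement G) v) + ∑[ v < n ] 1
      ≡⟨ ∑-distrib-+ (λ v → degree G v + degree (complement G) v) (λ _ → 1) ⟨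
    ∑[ v < n ] (degree G v + degree (complement G) v + 1)
      ≡⟨ sum-cong-≗ degree-partition ⟩
    ∑[ v < n ] n
      ≡⟨ sum-const n n ⟩
    n * n ∎
    where open ≡.≡-Reasoning

  sum-degree-complement : n * n ∸ n ∸ 2 * numEdges G ≡ ∑[ v < n ] degree (complement G) v
  sum-degree-complement = begin
    n * n ∸ n ∸ 2 * numEdges G
      ≡⟨ cong (λ m → m ∸ n ∸ 2 * numEdges G) handshake-complement ⟨
    2 * numEdges G + ∑[ v < n ] degree (complement G) v + n ∸ n ∸ 2 * numEdges G
      ≡⟨ cong (_∸ 2 * numEdges G) (m+n∸n≡m _ n) ⟩
    2 * numEdges G + ∑[ v < n ] degree (complement G) v ∸ 2 * numEdges G
      ≡⟨ m+n∸m≡n (2 * numEdges G) _ ⟩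
    ∑[ v < n ] degree (complement G) v ∎
    where open ≡.≡-Reasoning

TriangleFree : ∀ {n} → Graph n → Set
TriangleFree H = ∀ {a b c} → Adj H a b → Adj H b c → ¬ Adj H a c

C₄Free : ∀ {n} → Graph n → Set
C₄Free H =
  ∀ {a b c d} → a ≢ c → b ≢ d → Adj H a b → Adj H b c → Adj H c d → ¬ Adj H d a

codegree : ∀ {n} → Graph n → Fin n → Fin n → ℕ
codegree {n} H v w = ∑[ u < n ] (edge H v u * edge H u w)

module _ {n} (H : Graph n) where

  codegree-diagonal : ∀ v → codegree H v v ≡ degree H v
  codegree-diagonal v = sum-cong-≗ λ u →
    trans (cong (edge H v u *_) (edge-sym H u v)) (𝟙-idem (adj? H v u))

  edge*edge>0⇒adj : ∀ {v u w} → 0 < edge H v u * edge H u w → Adj H v u × Adj H u w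
  edge*edge>0⇒adj {v} {u} {w} _ with adj? H v u | adj? H u w
  edge*edge>0⇒adj () | no _  | _
  edge*edge>0⇒adj () | yes _ | no _
  ... | yes vu | yes uw = vu , uw

  codegree-adjacent : TriangleFree H → ∀ {v w} → Adj H v w → codegree H v w ≡ 0
  codegree-adjacent triangle-free {v} {w} vw =
    trans (sum-cong-≗ no-path) (sum-replicate-zero n)
    where
    no-path : ∀ u → edge H v u * edge H u w ≡ 0
    no-path u with 0 <? edge H v u * edge H u w
    ... | no ≯0 = n≤0⇒n≡0 (≮⇒≥ ≯0)
    ... | yes >0 with vu , uw ← edge*edge>0⇒adj >0 = ⊥-elim (triangle-free vu uw vw)

  codegree-nonadjacent : C₄Free H → ∀ {v w} → v ≢ w → codegree H v w ≤ 1
  codegree-nonadjacent c₄-free {v} {w} v≢w = sum-≤-1 _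
    (λ u → *-mono-≤ (𝟙-≤-1 (adj? H v u)) (𝟙-≤-1 (adj? H u w)))
    unique
    where
    unique : ∀ u u′ → 0 < edge H v u * edge H u w → 0 < edge H v u′ * edge H u′ w → u ≡ u′
    unique u u′ vuw vu′w with u ≟ u′ | edge*edge>0⇒adj vuw | edge*edge>0⇒adj vu′w
    ... | yes u≡u′ | _        | _          = u≡u′
    ... | no u≢u′  | vu , uw | vu′ , u′w =
      ⊥-elim (c₄-free v≢w u≢u′ vu uw (sym H u′w) (sym H vu′))

  codegree-≤ : TriangleFree H → C₄Free H →
    ∀ v w → codegree H v w ≤ 𝟙 (v ≟ w) * degree H v + edge (complement H) v w
  codegree-≤ triangle-free c₄-free v w with v ≟ w | adj? H v w
  ... | yes refl | _      =
    ≤-trans (≤-reflexive (trans (codegree-diagonal v) (≡.sym (+-identityʳ _)))) (m≤m+n _ _)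
  ... | no _     | yes vw = ≤-reflexive (codegree-adjacent triangle-free vw)
  ... | no v≢w   | no _   = codegree-nonadjacent c₄-free v≢w

  sum-codegree : ∀ v → ∑[ w < n ] codegree H v w ≡ ∑[ u < n ] (edge H v u * degree H u)
  sum-codegree v = begin
    ∑[ w < n ] ∑[ u < n ] (edge H v u * edge H u w)
      ≡⟨ ∑-comm (λ w u → edge H v u * edge H u w) ⟩
    ∑[ u < n ] ∑[ w < n ] (edge H v u * edge H u w)
      ≡⟨ sum-cong-≗ (λ u → *-distribˡ-sum (edge H v u) (edge H u)) ⟨
    ∑[ u < n ] (edge H v u * degree H u) ∎
    where open ≡.≡-Reasoning

  sum-neighbour-degree<n : TriangleFree H → C₄Free H →
    ∀ v → ∑[ u < n ] (edge H v u * degree H u) < n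
  sum-neighbour-degree<n triangle-free c₄-free v = begin-strict
    ∑[ u < n ] (edge H v u * degree H u)
      ≡⟨ sum-codegree v ⟨
    ∑[ w < n ] codegree H v w
      ≤⟨ sum-mono-≤ (codegree-≤ triangle-free c₄-free v) ⟩
    ∑[ w < n ] (𝟙 (v ≟ w) * degree H v + edge (complement H) v w)
      ≡⟨ ∑-distrib-+ (λ w → 𝟙 (v ≟ w) * degree H v) (edge (complement H) v) ⟩
    ∑[ w < n ] (𝟙 (v ≟ w) * degree H v) + degree (complement H) v
      ≡⟨ cong (_+ degree (complement H) v) (*-distribʳ-sum (degree H v) (λ w → 𝟙 (v ≟ w))) ⟨
    ∑[ w < n ] 𝟙 (v ≟ w) * degree H v + degree (complement H) v
      ≡⟨ cong (λ k → k * degree H v + degree (complement H) v) (sum-𝟙-≟ v) ⟩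
    1 * degree H v + degree (complement H) v
      ≡⟨ cong (_+ degree (complement H) v) (*-identityˡ (degree H v)) ⟩
    degree H v + degree (complement H) v
      <⟨ ≤-reflexive (trans (+-comm 1 _) (degree-partition H v)) ⟩
    n ∎
    where open ≤-Reasoning

  sum-degree-squared :
    ∑[ u < n ] (degree H u * degree H u) ≡ ∑[ v < n ] ∑[ u < n ] (edge H v u * degree H u)
  sum-degree-squared = begin
    ∑[ u < n ] (degree H u * degree H u)
      ≡⟨ sum-cong-≗ (λ u → *-distribʳ-sum (degree H u) (edge H u)) ⟩
    ∑[ u < n ] ∑[ v < n ] (edge H u v * degree H u)
      ≡⟨ sum-cong-≗ (λ u → sum-cong-≗ λ v → cong (_* degree H u) (edge-sym H u v)) ⟩
    ∑[ u < n ] ∑[ v < n ] (edge H v u * degree H u)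
      ≡⟨ ∑-comm (λ u v → edge H v u * degree H u) ⟩
    ∑[ v < n ] ∑[ u < n ] (edge H v u * degree H u) ∎
    where open ≡.≡-Reasoning

  sum-degree-squared+n≤n*n : TriangleFree H → C₄Free H →
    ∑[ u < n ] (degree H u * degree H u) + n ≤ n * n
  sum-degree-squared+n≤n*n triangle-free c₄-free =
    ≡.subst (λ s → s + n ≤ n * n) (≡.sym sum-degree-squared)
      (sum-< _ (sum-neighbour-degree<n triangle-free c₄-free))

  sum-degree^2<n^3 : .{{NonZero n}} → TriangleFree H → C₄Free H →
    (∑[ v < n ] degree H v) ^ 2 < n ^ 3
  sum-degree^2<n^3 triangle-free c₄-free = begin-strict
    s ^ 2      ≡⟨ cong (s *_) (*-identityʳ s) ⟩
    s * s      ≤⟨ cauchy-schwarz (degree H) ⟩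
    n * q      <⟨ *-monoʳ-< n (m<m+n q (>-nonZero⁻¹ n)) ⟩
    n * (q + n) ≤⟨ *-monoʳ-≤ n (sum-degree-squared+n≤n*n triangle-free c₄-free) ⟩
    n * (n * n) ≡⟨ cong (λ m → n * (n * m)) (*-identityʳ n) ⟨
    n ^ 3      ∎
    where
    open ≤-Reasoning
    s = ∑[ v < n ] degree H v
    q = ∑[ u < n ] (degree H u * degree H u)

OneOf : ∀ {m} → Fin m → Fin m → Fin m → Set
OneOf x y z = z ≡ x ⊎ z ≡ y

alternation : ∀ {k} {x y p q r : Fin k} → OneOf x y p → OneOf x y q → OneOf x y r →
                p ≢ q → q ≢ r → p ≡ r
alternation (inj₁ refl) _           (inj₁ refl) _   _   = refl
alternation (inj₂ refl) _           (inj₂ refl) _   _   = refl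
alternation (inj₁ refl) (inj₁ refl) (inj₂ refl) p≢q _   = ⊥-elim (p≢q refl)
alternation (inj₂ refl) (inj₂ refl) (inj₁ refl) p≢q _   = ⊥-elim (p≢q refl)
alternation (inj₁ refl) (inj₂ refl) (inj₂ refl) _   q≢r = ⊥-elim (q≢r refl)
alternation (inj₂ refl) (inj₁ refl) (inj₁ refl) _   q≢r = ⊥-elim (q≢r refl)

module _ {n} {G : Graph n} where

  starColoring-intro : ∀ {k} {col : Coloring n k} → Proper G col →
    (∀ a b c d → IsP4 G a b c d → col a ≡ col c → col b ≢ col d) →
    StarColoring G col
  starColoring-intro proper no-alternation = proper , bicoloured-p4
    where
    bicoloured-p4 : ∀ a b c d → IsP4 G a b c d → ¬ UsesAtMostTwoColors _ a b c d
    bicoloured-p4 a b c d p4@(_ , ab , bc , cd) (_ , _ , ∈a , ∈b , ∈c , ∈d) =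
      no-alternation a b c d p4
        (alternation ∈a ∈b ∈c (proper a b ab) (proper b c bc))
        (alternation ∈b ∈c ∈d (proper b c bc) (proper c d cd))

  starColoring-refine : ∀ {k k′} {col : Coloring n k} {col′ : Coloring n k′} →
    StarColoring G col → (∀ u v → col′ u ≡ col′ v → col u ≡ col v) → StarColoring G col′
  starColoring-refine {col = col} (proper , no-bicoloured-p4) refines =
    starColoring-intro (λ u v uv → proper u v uv ∘ refines u v) λ a b c d p4 ac bd →
      no-bicoloured-p4 a b c d p4
        (col a , col b , inj₁ refl , inj₂ refl ,
         inj₁ (≡.sym (refines a c ac)) , inj₂ (≡.sym (refines b d bd)))

  starColoring-punchOut : ∀ {k} {col : Coloring n (suc k)} {p} → StarColoring G col →
    (p∉col : ∀ v → p ≢ col v) → StarColoring G (λ v → punchOut (p∉col v))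
  starColoring-punchOut star p∉col =
    starColoring-refine star λ u v → punchOut-injective (p∉col u) (p∉col v)

  starColorable-omitting-two : ∀ {k} {col : Coloring n (suc (suc k))} {p q} →
    StarColoring G col → p ≢ q → (∀ v → p ≢ col v) → (∀ v → q ≢ col v) → StarColorable G k
  starColorable-omitting-two star p≢q p∉col q∉col =
    _ , starColoring-punchOut (starColoring-punchOut star p∉col) q′∉col′
    where
    q′∉col′ : ∀ v → punchOut p≢q ≢ punchOut (p∉col v)
    q′∉col′ v = q∉col v ∘ punchOut-injective p≢q (p∉col v)

module _ {k} (G : Graph (suc (suc k))) where

  private
    Ḡ : Graph (suc (suc k))
    Ḡ = complement G

  starColorable-of-triangle : ∀ {a b c} → Adj Ḡ a b → Adj Ḡ b c → Adj Ḡ a c → StarColorable G k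
  starColorable-of-triangle {a} {b} {c} ab bc ac =
    starColorable-omitting-two {G = G} (starColoring-intro {G = G} proper no-alternation)
      (proj₁ bc) b∉merge c∉merge
    where
    merge : Fin (suc (suc k)) → Fin (suc (suc k))
    merge x with x ≟ b | x ≟ c
    ... | no _ | no _ = x
    ... | _    | _    = a

    data MergeView (x : Fin (suc (suc k))) : Fin (suc (suc k)) → Set where
      merged : OneOf b c x → MergeView x a
      kept   : x ≢ b → x ≢ c → MergeView x x

    merge-view : ∀ x → MergeView x (merge x)
    merge-view x with x ≟ b | x ≟ c
    ... | no x≢b  | no x≢c  = kept x≢b x≢c
    ... | yes x≡b | _       = merged (inj₁ x≡b)
    ... | no _    | yes x≡c = merged (inj₂ x≡c)

    b∉merge : ∀ x → b ≢ merge x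
    b∉merge x with merge x | merge-view x
    ... | _ | merged _   = proj₁ ab ∘ ≡.sym
    ... | _ | kept x≢b _ = x≢b ∘ ≡.sym

    c∉merge : ∀ x → c ≢ merge x
    c∉merge x with merge x | merge-view x
    ... | _ | merged _   = proj₁ ac ∘ ≡.sym
    ... | _ | kept _ x≢c = x≢c ∘ ≡.sym

    Merged : Fin (suc (suc k)) → Set
    Merged x = x ≡ a ⊎ OneOf b c x

    merge-fibre : ∀ x y → merge x ≡ merge y → x ≡ y ⊎ (Merged x × Merged y)
    merge-fibre x y with merge x | merge-view x | merge y | merge-view y
    ... | _ | merged x∈ | _ | merged y∈ = λ _    → inj₂ (inj₂ x∈ , inj₂ y∈)
    ... | _ | merged x∈ | _ | kept _ _  = λ { refl → inj₂ (inj₂ x∈ , inj₁ refl) }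
    ... | _ | kept _ _  | _ | merged y∈ = λ { refl → inj₂ (inj₁ refl , inj₂ y∈) }
    ... | _ | kept _ _  | _ | kept _ _  = inj₁

    merged-independent : ∀ {x y} → Merged x → Merged y → ¬ Adj G x y
    merged-independent (inj₁ refl)        (inj₁ refl)        = irrefl G a
    merged-independent (inj₁ refl)        (inj₂ (inj₁ refl)) = proj₂ ab
    merged-independent (inj₁ refl)        (inj₂ (inj₂ refl)) = proj₂ ac
    merged-independent (inj₂ (inj₁ refl)) (inj₁ refl)        = proj₂ ab ∘ sym G
    merged-independent (inj₂ (inj₁ refl)) (inj₂ (inj₁ refl)) = irrefl G b
    merged-independent (inj₂ (inj₁ refl)) (inj₂ (inj₂ refl)) = proj₂ bc
    merged-independent (inj₂ (inj₂ refl)) (inj₁ refl)        = proj₂ ac ∘ sym G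
    merged-independent (inj₂ (inj₂ refl)) (inj₂ (inj₁ refl)) = proj₂ bc ∘ sym G
    merged-independent (inj₂ (inj₂ refl)) (inj₂ (inj₂ refl)) = irrefl G c

    proper : Proper G merge
    proper u v uv u~v with merge-fibre u v u~v
    ... | inj₁ refl       = irrefl G u uv
    ... | inj₂ (mu , mv) = merged-independent mu mv uv

    no-alternation : ∀ p q r s → IsP4 G p q r s → merge p ≡ merge r → merge q ≢ merge s
    no-alternation p q r s ((_ , p≢r , _ , _ , q≢s , _) , pq , _) p~r q~s
      with merge-fibre p r p~r | merge-fibre q s q~s
    ... | inj₁ p≡r       | _              = p≢r p≡r
    ... | _              | inj₁ q≡s       = q≢s q≡s
    ... | inj₂ (mp , _) | inj₂ (mq , _) = merged-independent mp mq pq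

  independent-pair : ∀ {a b x y} → Adj Ḡ a b → OneOf a b x → OneOf a b y → ¬ Adj G x y
  independent-pair _        (inj₁ refl) (inj₁ refl) = irrefl G _
  independent-pair _        (inj₂ refl) (inj₂ refl) = irrefl G _
  independent-pair (_ , ab) (inj₁ refl) (inj₂ refl) = ab
  independent-pair (_ , ab) (inj₂ refl) (inj₁ refl) = ab ∘ sym G

  common-neighbour-of-pair : ∀ {a b c d x y z} →
    Adj Ḡ a b → Adj Ḡ b c → Adj Ḡ c d → Adj Ḡ d a →
    OneOf a b x → OneOf a b z → x ≢ z → OneOf c d y → Adj G x y → Adj G z y → ⊥
  common-neighbour-of-pair _ _        _ _        (inj₁ refl) (inj₁ refl) x≢z _ _ _ = x≢z refl
  common-neighbour-of-pair _ _        _ _        (inj₂ refl) (inj₂ refl) x≢z _ _ _ = x≢z refl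
  common-neighbour-of-pair _ (_ , bc) _ _        (inj₁ refl) (inj₂ refl) _ (inj₁ refl) _ zy = bc zy
  common-neighbour-of-pair _ _        _ (_ , da) (inj₁ refl) (inj₂ refl) _ (inj₂ refl) xy _  =
    da (sym G xy)
  common-neighbour-of-pair _ (_ , bc) _ _        (inj₂ refl) (inj₁ refl) _ (inj₁ refl) xy _  = bc xy
  common-neighbour-of-pair _ _        _ (_ , da) (inj₂ refl) (inj₁ refl) _ (inj₂ refl) _ zy =
    da (sym G zy)

  starColorable-of-square : ∀ {a b c d} → a ≢ c → b ≢ d →
    Adj Ḡ a b → Adj Ḡ b c → Adj Ḡ c d → Adj Ḡ d a →
    StarColorable G k
  starColorable-of-square {a} {b} {c} {d} a≢c b≢d ab bc cd da =
    starColorable-omitting-two {G = G} (starColoring-intro {G = G} proper no-alternation)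
      b≢d b∉merge d∉merge
    where
    merge : Fin (suc (suc k)) → Fin (suc (suc k))
    merge x with x ≟ b | x ≟ d
    ... | yes _ | _     = a
    ... | no _  | yes _ = c
    ... | no _  | no _  = x

    data MergeView (x : Fin (suc (suc k))) : Fin (suc (suc k)) → Set where
      b↦a  : x ≡ b → MergeView x a
      d↦c  : x ≡ d → MergeView x c
      kept : x ≢ b → x ≢ d → MergeView x x

    merge-view : ∀ x → MergeView x (merge x)
    merge-view x with x ≟ b | x ≟ d
    ... | yes x≡b | _       = b↦a x≡b
    ... | no _    | yes x≡d = d↦c x≡d
    ... | no x≢b  | no x≢d  = kept x≢b x≢d

    b∉merge : ∀ x → b ≢ merge x
    b∉merge x with merge x | merge-view x
    ... | _ | b↦a _      = proj₁ ab ∘ ≡.sym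
    ... | _ | d↦c _      = proj₁ bc
    ... | _ | kept x≢b _ = x≢b ∘ ≡.sym

    d∉merge : ∀ x → d ≢ merge x
    d∉merge x with merge x | merge-view x
    ... | _ | b↦a _      = proj₁ da
    ... | _ | d↦c _      = proj₁ cd ∘ ≡.sym
    ... | _ | kept _ x≢d = x≢d ∘ ≡.sym

    merge-fibre : ∀ x y → merge x ≡ merge y →
      x ≡ y ⊎ (OneOf a b x × OneOf a b y) ⊎ (OneOf c d x × OneOf c d y)
    merge-fibre x y with merge x | merge-view x | merge y | merge-view y
    ... | _ | b↦a x≡b | _ | b↦a y≡b = λ _ → inj₂ (inj₁ (inj₂ x≡b , inj₂ y≡b))
    ... | _ | b↦a _   | _ | d↦c _   = ⊥-elim ∘ a≢c
    ... | _ | b↦a x≡b | _ | kept _ _ = λ { refl → inj₂ (inj₁ (inj₂ x≡b , inj₁ refl)) }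
    ... | _ | d↦c _   | _ | b↦a _   = ⊥-elim ∘ a≢c ∘ ≡.sym
    ... | _ | d↦c x≡d | _ | d↦c y≡d = λ _ → inj₂ (inj₂ (inj₂ x≡d , inj₂ y≡d))
    ... | _ | d↦c x≡d | _ | kept _ _ = λ { refl → inj₂ (inj₂ (inj₂ x≡d , inj₁ refl)) }
    ... | _ | kept _ _ | _ | b↦a y≡b = λ { refl → inj₂ (inj₁ (inj₁ refl , inj₂ y≡b)) }
    ... | _ | kept _ _ | _ | d↦c y≡d = λ { refl → inj₂ (inj₂ (inj₁ refl , inj₂ y≡d)) }
    ... | _ | kept _ _ | _ | kept _ _ = inj₁

    proper : Proper G merge
    proper u v uv u~v with merge-fibre u v u~v
    ... | inj₁ refl              = irrefl G u uv
    ... | inj₂ (inj₁ (u∈ , v∈)) = independent-pair ab u∈ v∈ uv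
    ... | inj₂ (inj₂ (u∈ , v∈)) = independent-pair cd u∈ v∈ uv

    no-alternation : ∀ p q r s → IsP4 G p q r s → merge p ≡ merge r → merge q ≢ merge s
    no-alternation p q r s ((_ , p≢r , _ , _ , q≢s , _) , pq , qr , _) p~r q~s
      with merge-fibre p r p~r | merge-fibre q s q~s
    ... | inj₁ p≡r | _ = p≢r p≡r
    ... | _ | inj₁ q≡s = q≢s q≡s
    ... | inj₂ (inj₁ (p∈ , _))  | inj₂ (inj₁ (q∈ , _)) = independent-pair ab p∈ q∈ pq
    ... | inj₂ (inj₂ (p∈ , _))  | inj₂ (inj₂ (q∈ , _)) = independent-pair cd p∈ q∈ pq
    ... | inj₂ (inj₁ (p∈ , r∈)) | inj₂ (inj₂ (q∈ , _)) =
      common-neighbour-of-pair ab bc cd da p∈ r∈ p≢r q∈ pq (sym G qr)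
    ... | inj₂ (inj₂ (p∈ , r∈)) | inj₂ (inj₁ (q∈ , _)) =
      common-neighbour-of-pair cd da ab bc p∈ r∈ p≢r q∈ pq (sym G qr)

module _ {k} (G : Graph (suc (suc k))) (¬colourable : ¬ StarColorable G k) where

  triangleFree-complement : TriangleFree (complement G)
  triangleFree-complement ab bc ac = ¬colourable (starColorable-of-triangle G ab bc ac)

  c₄Free-complement : C₄Free (complement G)
  c₄Free-complement a≢c b≢d ab bc cd da =
    ¬colourable (starColorable-of-square G a≢c b≢d ab bc cd da)

mainTheorem13 : (n : ℕ) → 5 ≤ n → (G : Graph n) → Connected G →
                StarChromaticNumber G (n ∸ 1) →
                (n * n ∸ n ∸ 2 * numEdges G) ^ 2 < n ^ 3
mainTheorem13 n@(suc (suc k)) _ G _ (_ , minimal) = begin-strict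
  (n * n ∸ n ∸ 2 * numEdges G) ^ 2
    ≡⟨ cong (_^ 2) (sum-degree-complement G) ⟩
  (∑[ v < n ] degree (complement G) v) ^ 2
    <⟨ sum-degree^2<n^3 (complement G) (triangleFree-complement G ¬colourable)
                                       (c₄Free-complement G ¬colourable) ⟩
  n ^ 3 ∎
  where
  open ≤-Reasoning
  ¬colourable : ¬ StarColorable G k
  ¬colourable = minimal k (n<1+n k)
mainTheorem13 1 (s≤s ()) _ _ _
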